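{- Let $r$ be a positive integer and let $\mathbb{M}=(V,\mathcal{C})$ be the rank-$r$ uniform matroid on $n\ge r+2$ elements, i.e. $\mathcal{C}=\{C\subseteq V:|C|=r+1\}$, $|V|=n$. Let $|\mathbb{M}|_C$ be the minimum cardinality of a subfamily $\mathcal{D}\subseteq\mathcal{C}$ with $\Phi_{\mathcal{D}}=\Phi_{\mathcal{C}}$. Then $\binom{n}{r}\big/\left(r+\tfrac12\right)\le|\mathbb{M}|_C\le\binom{n}{r}$.
   Context: Boolean functions on $V$ are viewed as functions of subsets of $V$. The clause $B\to v$ ($v\notin B$) is the function whose true sets are the $T$ with $B\not\subseteq T$ or $B\cup\{v\}\subseteq T$; for $\mathcal{H}\subseteq 2^V$, $\Phi_{\mathcal{H}}=\bigwedge_{H\in\mathcal{H}}\bigwedge_{v\in H}((H\setminus\{v\})\to v)$; equality of CNFs means equality as Boolean functions. -}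

module Defs where

open import Data.Nat using (ℕ; suc)
open import Data.Fin using (Fin)
open import Data.Fin.Subset using (Subset; _∈_; _⊆_; _⊈_; _∪_; _-_; ⁅_⁆; ∣_∣)
open import Data.Sum using (_⊎_)
open import Data.List using (List)
open import Data.List.Membership.Propositional renaming (_∈_ to _∈ₗ_)
open import Function.Bundles using (_⇔_)

-- A truth assignment / "set" T ⊆ V = Fin n is a Subset n.
-- The clause  B → v  is true at T iff  B ⊈ T  or  B ∪ {v} ⊆ T.
ClauseTrue : ∀ {n} → Subset n → Fin n → Subset n → Set
ClauseTrue B v T = (B ⊈ T) ⊎ ((B ∪ ⁅ v ⁆) ⊆ T)

-- Φ_ℋ for a family ℋ given by a membership predicate on subsets:
-- T is a true set of Φ_ℋ iff every clause (H ∖ {v}) → v, H ∈ ℋ, v ∈ H, holds at T.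
PhiTrue : ∀ {n} → (Subset n → Set) → Subset n → Set
PhiTrue {n} ℋ T = ∀ (H : Subset n) → ℋ H → ∀ (v : Fin n) → v ∈ H → ClauseTrue (H - v) v T

SameFunction : ∀ {n} → (Subset n → Set) → (Subset n → Set) → Set
SameFunction {n} ℋ 𝒢 = ∀ (T : Subset n) → PhiTrue ℋ T ⇔ PhiTrue 𝒢 T

UniformCircuit : ∀ {n} → ℕ → Subset n → Set
UniformCircuit r C = ∣ C ∣ ≡ suc r
  where open import Relation.Binary.PropositionalEquality using (_≡_)

-- A finite family given by a list (duplicate-free lists are used so that length = cardinality).
ListFamily : ∀ {n} → List (Subset n) → Subset n → Set
ListFamily 𝒟 H = H ∈ₗ 𝒟

{-# OPTIONS --safe #-}

-- A set T satisfies Φ_ℋ iff it is closed under the rules H ∖ {v} ⊆ T ⇒ v ∈ T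
-- (H ∈ ℋ, v ∈ H). For uniform circuits the closed sets are V and the sets containing
-- no r-set, so a subfamily 𝒟 represents Φ_𝒞 iff every T ≠ V containing an r-set
-- breaks a rule of 𝒟.
--
-- Upper bound: the circuits through the point 0 suffice. If T contains an r-set S and
-- misses w, then either 0 ∉ T (break the rule of S ∪ {0}), or 0 ∈ S (that of S ∪ {w}),
-- or 0 ∈ T ∖ S (exchange a point of S for 0 and use the new r-set ∪ {w}).
--
-- Lower bound: let c(B) be the number of H ∈ 𝒟 containing the r-set B, and c₂(B) = c(B)
-- if c(B) ≥ 2 and 0 otherwise. Breaking a rule at T = B shows c(B) ≥ 1, hence
-- 2 + c₂(B) ≤ 2 c(B). Breaking a rule at T = H ∈ 𝒟 gives a face of H shared with another
-- member of 𝒟, hence Σ c₂ ≥ |𝒟|; and Σ c = (r+1)|𝒟| by double counting. Summing over the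
-- C(n,r) r-sets, 2 C(n,r) + |𝒟| ≤ 2 (r+1) |𝒟|.
module Submission where

open import Defs
open import Data.Nat using (ℕ; zero; suc; _+_; _*_; _≤_; _<_; _≥_; z≤n; s≤s; _≤?_)
open import Data.Nat.Properties
open import Algebra.Properties.CommutativeSemigroup +-commutativeSemigroup using (interchange)
open import Data.Nat.Combinatorics using (_C_; nCk+nC[k+1]≡[n+1]C[k+1]; nCk≡nC[n∸k]; nC1≡n)
open import Data.Nat.Solver using (module +-*-Solver)
open import Data.Fin using (Fin; zero; suc)
open import Data.Fin.Properties using (any?)
open import Data.Fin.Subset
open import Data.Fin.Subset.Properties
open import Data.Vec using ([]; _∷_; here; there)
open import Data.Vec.Properties using (∷-injectiveʳ)
open import Data.List using (List; []; _∷_; _++_; map; length)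
open import Data.List.Properties using (length-map; length-++)
open import Data.List.Relation.Unary.Any using (here; there)
import Data.List.Relation.Unary.Any as Any
open import Data.List.Relation.Unary.All using (All; []; tabulate; lookup)
open import Data.List.Relation.Unary.AllPairs using ([]; _∷_)
open import Data.List.Membership.Propositional using (find; lose) renaming (_∈_ to _∈ₗ_)
open import Data.List.Membership.Propositional.Properties
  using (∈-map⁺; ∈-map⁻; ∈-++⁺ˡ; ∈-++⁺ʳ; ∈-++⁻)
open import Data.List.Relation.Unary.Unique.Propositional using (Unique)
import Data.List.Relation.Unary.Unique.Propositional.Properties as Unique
open import Data.Product using (Σ; ∃; _×_; _,_; proj₁; proj₂)
open import Data.Sum using (inj₁; inj₂)
open import Function using (_∘_)
open import Function.Bundles using (_⇔_; mk⇔; Equivalence)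
open import Function.Properties.Equivalence using () renaming (sym to ⇔-sym; trans to ⇔-trans)
open import Relation.Nullary using (¬_; Dec; yes; no; contradiction)
open import Relation.Nullary.Decidable using (¬?; _×-dec_; map′; decidable-stable)
open import Relation.Unary using (Decidable)
open import Relation.Binary.PropositionalEquality

open Equivalence using (to; from)

private
  variable
    A B : Set
    n r : ℕ
    x y : Fin n
    p q S T H : Subset n

sumOver : List A → (A → ℕ) → ℕ
sumOver []       f = 0
sumOver (x ∷ xs) f = f x + sumOver xs f

syntax sumOver xs (λ x → e) = ∑[ x ∈ xs ] e

∑-+ : (xs : List A) (f g : A → ℕ) →
      ∑[ x ∈ xs ] (f x + g x) ≡ ∑[ x ∈ xs ] f x + ∑[ x ∈ xs ] g x
∑-+ []       f g = refl
∑-+ (x ∷ xs) f g = trans (cong (f x + g x +_) (∑-+ xs f g)) (interchange (f x) (g x) _ _)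

∑-* : (c : ℕ) (xs : List A) (f : A → ℕ) →
      ∑[ x ∈ xs ] (c * f x) ≡ c * ∑[ x ∈ xs ] f x
∑-* c []       f = sym (*-zeroʳ c)
∑-* c (x ∷ xs) f = trans (cong (c * f x +_) (∑-* c xs f)) (sym (*-distribˡ-+ c (f x) _))

∑-const : (c : ℕ) (xs : List A) → ∑[ x ∈ xs ] c ≡ c * length xs
∑-const c []       = sym (*-zeroʳ c)
∑-const c (x ∷ xs) = trans (cong (c +_) (∑-const c xs)) (sym (*-suc c (length xs)))

∑-cong : (xs : List A) {f g : A → ℕ} → (∀ {x} → x ∈ₗ xs → f x ≡ g x) →
         ∑[ x ∈ xs ] f x ≡ ∑[ x ∈ xs ] g x
∑-cong []       f≗g = refl
∑-cong (x ∷ xs) f≗g = cong₂ _+_ (f≗g (here refl)) (∑-cong xs (f≗g ∘ there))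

∑-mono : (xs : List A) {f g : A → ℕ} → (∀ {x} → x ∈ₗ xs → f x ≤ g x) →
         ∑[ x ∈ xs ] f x ≤ ∑[ x ∈ xs ] g x
∑-mono []       f≤g = z≤n
∑-mono (x ∷ xs) f≤g = +-mono-≤ (f≤g (here refl)) (∑-mono xs (f≤g ∘ there))

∑-swap : (xs : List A) (ys : List B) (g : A → B → ℕ) →
         ∑[ x ∈ xs ] ∑[ y ∈ ys ] g x y ≡ ∑[ y ∈ ys ] ∑[ x ∈ xs ] g x y
∑-swap xs []       g = ∑-const 0 xs
∑-swap xs (y ∷ ys) g =
  trans (∑-+ xs (λ x → g x y) (λ x → ∑[ y′ ∈ ys ] g x y′))
        (cong (∑[ x ∈ xs ] g x y +_) (∑-swap xs ys g))

∑-++ : (xs ys : List A) (f : A → ℕ) →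
       ∑[ x ∈ xs ++ ys ] f x ≡ ∑[ x ∈ xs ] f x + ∑[ y ∈ ys ] f y
∑-++ []       ys f = refl
∑-++ (x ∷ xs) ys f = trans (cong (f x +_) (∑-++ xs ys f)) (sym (+-assoc (f x) _ _))

∑-map : (h : A → B) (xs : List A) (f : B → ℕ) →
        ∑[ y ∈ map h xs ] f y ≡ ∑[ x ∈ xs ] f (h x)
∑-map h []       f = refl
∑-map h (x ∷ xs) f = cong (f (h x) +_) (∑-map h xs f)

indicator : {P : Set} → Dec P → ℕ
indicator (yes _) = 1
indicator (no _)  = 0

indicator-cong : {P Q : Set} → P ⇔ Q → (P? : Dec P) (Q? : Dec Q) →
                 indicator P? ≡ indicator Q?
indicator-cong P⇔Q (yes _)  (yes _)  = refl
indicator-cong P⇔Q (yes p)  (no ¬q)  = contradiction (to P⇔Q p) ¬q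
indicator-cong P⇔Q (no ¬p)  (yes q)  = contradiction (from P⇔Q q) ¬p
indicator-cong P⇔Q (no _)   (no _)   = refl

count : {P : A → Set} → Decidable P → List A → ℕ
count P? xs = ∑[ x ∈ xs ] indicator (P? x)

module _ {P : A → Set} (P? : Decidable P) where

  count-cong : {Q : A → Set} (Q? : Decidable Q) (xs : List A) →
               (∀ x → P x ⇔ Q x) → count P? xs ≡ count Q? xs
  count-cong Q? xs P⇔Q = ∑-cong xs λ {x} _ → indicator-cong (P⇔Q x) (P? x) (Q? x)

  count-none : (xs : List A) → (∀ x → ¬ P x) → count P? xs ≡ 0
  count-none []       ¬P = refl
  count-none (x ∷ xs) ¬P with P? x
  ... | yes Px = contradiction Px (¬P x)
  ... | no _   = count-none xs ¬P

  count-pos : {xs : List A} {x : A} → x ∈ₗ xs → P x → 0 < count P? xs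
  count-pos {x ∷ xs} (here refl) Px with P? x
  ... | yes _  = s≤s z≤n
  ... | no ¬Px = contradiction Px ¬Px
  count-pos {y ∷ xs} (there x∈xs) Px = ≤-trans (count-pos x∈xs Px) (m≤n+m _ _)

  count≥2 : {xs : List A} {x y : A} → x ∈ₗ xs → y ∈ₗ xs → x ≢ y → P x → P y →
            2 ≤ count P? xs
  count≥2 (here refl) (here refl) x≢y _ _ = contradiction refl x≢y
  count≥2 {z ∷ zs} (here refl) (there y∈zs) _ Pz Py with P? z
  ... | yes _  = s≤s (count-pos y∈zs Py)
  ... | no ¬Pz = contradiction Pz ¬Pz
  count≥2 {z ∷ zs} (there x∈zs) (here refl) _ Px Pz with P? z
  ... | yes _  = s≤s (count-pos x∈zs Px)
  ... | no ¬Pz = contradiction Pz ¬Pz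
  count≥2 (there x∈zs) (there y∈zs) x≢y Px Py =
    ≤-trans (count≥2 x∈zs y∈zs x≢y Px Py) (m≤n+m _ _)

count-map : {P : B → Set} (P? : Decidable P) (h : A → B) (xs : List A) →
            count P? (map h xs) ≡ count (P? ∘ h) xs
count-map P? h xs = ∑-map h xs (indicator ∘ P?)

count-++ : {P : A → Set} (P? : Decidable P) (xs ys : List A) →
           count P? (xs ++ ys) ≡ count P? xs + count P? ys
count-++ P? xs ys = ∑-++ xs ys (indicator ∘ P?)

[1+n]Cn≡1+n : ∀ n → suc n C n ≡ suc n
[1+n]Cn≡1+n n =
  trans (nCk≡nC[n∸k] (n≤1+n n)) (trans (cong (suc n C_) (m+n∸n≡m 1 n)) (nC1≡n (suc n)))

subsetsOfSize : (n k : ℕ) → List (Subset n)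
subsetsOfSize zero    zero    = [] ∷ []
subsetsOfSize zero    (suc k) = []
subsetsOfSize (suc n) zero    = map (outside ∷_) (subsetsOfSize n zero)
subsetsOfSize (suc n) (suc k) =
  map (inside ∷_) (subsetsOfSize n k) ++ map (outside ∷_) (subsetsOfSize n (suc k))

∈-subsetsOfSize⁻ : ∀ {k} → p ∈ₗ subsetsOfSize n k → ∣ p ∣ ≡ k
∈-subsetsOfSize⁻ {n = zero} {k = zero} (here refl) = refl
∈-subsetsOfSize⁻ {n = suc n} {k = zero} p∈ with ∈-map⁻ _ p∈
... | q , q∈ , refl = ∈-subsetsOfSize⁻ q∈
∈-subsetsOfSize⁻ {n = suc n} {k = suc k} p∈
  with ∈-++⁻ (map (inside ∷_) (subsetsOfSize n k)) p∈
... | inj₁ p∈ins with ∈-map⁻ _ p∈ins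
...   | q , q∈ , refl = cong suc (∈-subsetsOfSize⁻ q∈)
∈-subsetsOfSize⁻ {n = suc n} {k = suc k} p∈ | inj₂ p∈outs with ∈-map⁻ _ p∈outs
...   | q , q∈ , refl = ∈-subsetsOfSize⁻ q∈

∈-subsetsOfSize⁺ : ∀ {k} → ∣ p ∣ ≡ k → p ∈ₗ subsetsOfSize n k
∈-subsetsOfSize⁺ {p = []}          {zero}  refl = here refl
∈-subsetsOfSize⁺ {p = inside ∷ p}  {suc k} ∣p∣ =
  ∈-++⁺ˡ (∈-map⁺ (inside ∷_) (∈-subsetsOfSize⁺ (suc-injective ∣p∣)))
∈-subsetsOfSize⁺ {p = outside ∷ p} {zero}  ∣p∣ =
  ∈-map⁺ (outside ∷_) (∈-subsetsOfSize⁺ ∣p∣)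
∈-subsetsOfSize⁺ {p = outside ∷ p} {suc k} ∣p∣ =
  ∈-++⁺ʳ (map (inside ∷_) _) (∈-map⁺ (outside ∷_) (∈-subsetsOfSize⁺ ∣p∣))

subsetsOfSize-unique : ∀ n k → Unique (subsetsOfSize n k)
subsetsOfSize-unique zero    zero    = [] ∷ []
subsetsOfSize-unique zero    (suc k) = []
subsetsOfSize-unique (suc n) zero    = Unique.map⁺ ∷-injectiveʳ (subsetsOfSize-unique n zero)
subsetsOfSize-unique (suc n) (suc k) =
  Unique.++⁺ (Unique.map⁺ ∷-injectiveʳ (subsetsOfSize-unique n k))
             (Unique.map⁺ ∷-injectiveʳ (subsetsOfSize-unique n (suc k)))
             disjoint
  where
  disjoint : ∀ {p} → ¬ (p ∈ₗ map (inside ∷_) _ × p ∈ₗ map (outside ∷_) _)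
  disjoint (p∈ins , p∈outs) with ∈-map⁻ _ p∈ins | ∈-map⁻ _ p∈outs
  ... | _ , _ , refl | _ , _ , ()

length-subsetsOfSize : ∀ n k → length (subsetsOfSize n k) ≡ n C k
length-subsetsOfSize zero    zero    = refl
length-subsetsOfSize zero    (suc k) = refl
length-subsetsOfSize (suc n) zero    =
  trans (length-map (outside ∷_) (subsetsOfSize n zero)) (length-subsetsOfSize n zero)
length-subsetsOfSize (suc n) (suc k) =
  trans (length-++ (map (inside ∷_) ins))
        (trans (cong₂ _+_ (trans (length-map _ ins) (length-subsetsOfSize n k))
                          (trans (length-map _ outs) (length-subsetsOfSize n (suc k))))
               (nCk+nC[k+1]≡[n+1]C[k+1] n k))
  where
  ins outs : List (Subset n)
  ins  = subsetsOfSize n k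
  outs = subsetsOfSize n (suc k)

count-subsetsOfSize-suc : {P : Subset (suc n) → Set} (P? : Decidable P) (k : ℕ) →
                          count P? (subsetsOfSize (suc n) (suc k)) ≡
                          count (P? ∘ (inside ∷_)) (subsetsOfSize n k) +
                          count (P? ∘ (outside ∷_)) (subsetsOfSize n (suc k))
count-subsetsOfSize-suc {n} P? k =
  trans (count-++ P? (map (inside ∷_) ins) (map (outside ∷_) outs))
        (cong₂ _+_ (count-map P? (inside ∷_) ins) (count-map P? (outside ∷_) outs))
  where
  ins outs : List (Subset n)
  ins  = subsetsOfSize n k
  outs = subsetsOfSize n (suc k)

count-⊆-∷ : ∀ {s t} (xs : List (Subset n)) →
            (∀ {q} → q ⊆ H ⇔ s ∷ q ⊆ t ∷ H) →
            count ((_⊆? t ∷ H) ∘ (s ∷_)) xs ≡ count (_⊆? H) xs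
count-⊆-∷ xs ⊆⇔∷⊆ = count-cong _ _ xs (λ _ → ⇔-sym ⊆⇔∷⊆)

count-⊆-subsetsOfSize : ∀ n k (H : Subset n) →
                        count (_⊆? H) (subsetsOfSize n k) ≡ ∣ H ∣ C k
count-⊆-subsetsOfSize zero    zero    []            = refl
count-⊆-subsetsOfSize zero    (suc k) []            = refl
count-⊆-subsetsOfSize (suc n) zero    (s ∷ H)       =
  trans (count-map (_⊆? s ∷ H) (outside ∷_) (subsetsOfSize n zero))
        (trans (count-⊆-∷ (subsetsOfSize n zero) out⊆-⇔) (count-⊆-subsetsOfSize n zero H))
count-⊆-subsetsOfSize (suc n) (suc k) (inside ∷ H)  =
  trans (count-subsetsOfSize-suc (_⊆? inside ∷ H) k)
        (trans (cong₂ _+_ with-0 without-0) (nCk+nC[k+1]≡[n+1]C[k+1] ∣ H ∣ k))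
  where
  with-0 : count ((_⊆? inside ∷ H) ∘ (inside ∷_)) (subsetsOfSize n k) ≡ ∣ H ∣ C k
  with-0 = trans (count-⊆-∷ (subsetsOfSize n k) in⊆in-⇔) (count-⊆-subsetsOfSize n k H)
  without-0 : count ((_⊆? inside ∷ H) ∘ (outside ∷_)) (subsetsOfSize n (suc k)) ≡
              ∣ H ∣ C suc k
  without-0 = trans (count-⊆-∷ (subsetsOfSize n (suc k)) out⊆-⇔)
                    (count-⊆-subsetsOfSize n (suc k) H)
count-⊆-subsetsOfSize (suc n) (suc k) (outside ∷ H) =
  trans (count-subsetsOfSize-suc (_⊆? outside ∷ H) k) (cong₂ _+_ with-0 without-0)
  where
  with-0 : count ((_⊆? outside ∷ H) ∘ (inside ∷_)) (subsetsOfSize n k) ≡ 0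
  with-0 = count-none ((_⊆? outside ∷ H) ∘ (inside ∷_)) (subsetsOfSize n k)
                      λ _ in⊆out → contradiction (in⊆out here) λ ()
  without-0 : count ((_⊆? outside ∷ H) ∘ (outside ∷_)) (subsetsOfSize n (suc k)) ≡
              ∣ H ∣ C suc k
  without-0 = trans (count-⊆-∷ (subsetsOfSize n (suc k)) out⊆-⇔)
                    (count-⊆-subsetsOfSize n (suc k) H)

x∈p⇒suc∣p-x∣≡∣p∣ : x ∈ p → suc ∣ p - x ∣ ≡ ∣ p ∣
x∈p⇒suc∣p-x∣≡∣p∣ {p = inside ∷ p}  here        = cong (suc ∘ ∣_∣) (p─⊥≡p p)
x∈p⇒suc∣p-x∣≡∣p∣ {p = inside ∷ p}  (there x∈p) = cong suc (x∈p⇒suc∣p-x∣≡∣p∣ x∈p)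
x∈p⇒suc∣p-x∣≡∣p∣ {p = outside ∷ p} (there x∈p) = x∈p⇒suc∣p-x∣≡∣p∣ x∈p

x∉p⇒∣p∪⁅x⁆∣≡suc∣p∣ : x ∉ p → ∣ p ∪ ⁅ x ⁆ ∣ ≡ suc ∣ p ∣
x∉p⇒∣p∪⁅x⁆∣≡suc∣p∣ {x = zero}  {inside ∷ p}  x∉p = contradiction here x∉p
x∉p⇒∣p∪⁅x⁆∣≡suc∣p∣ {x = zero}  {outside ∷ p} _   = cong (suc ∘ ∣_∣) (∪-identityʳ p)
x∉p⇒∣p∪⁅x⁆∣≡suc∣p∣ {x = suc x} {inside ∷ p}  x∉p =
  cong suc (x∉p⇒∣p∪⁅x⁆∣≡suc∣p∣ (x∉p ∘ there))
x∉p⇒∣p∪⁅x⁆∣≡suc∣p∣ {x = suc x} {outside ∷ p} x∉p =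
  x∉p⇒∣p∪⁅x⁆∣≡suc∣p∣ (x∉p ∘ there)

x∉p⇒y∈p⇒∣p-y∪⁅x⁆∣≡∣p∣ : x ∉ p → y ∈ p → ∣ (p - y) ∪ ⁅ x ⁆ ∣ ≡ ∣ p ∣
x∉p⇒y∈p⇒∣p-y∪⁅x⁆∣≡∣p∣ {p = p} {y = y} x∉p y∈p =
  trans (x∉p⇒∣p∪⁅x⁆∣≡suc∣p∣ (x∉p ∘ p─q⊆p p ⁅ y ⁆))
        (x∈p⇒suc∣p-x∣≡∣p∣ y∈p)

x∉p-x : ∀ x → x ∉ p - x
x∉p-x {p = s ∷ p} zero    ()
x∉p-x {p = s ∷ p} (suc x) (there x∈p-x) = x∉p-x x x∈p-x

x∈p∪⁅x⁆ : x ∈ p ∪ ⁅ x ⁆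
x∈p∪⁅x⁆ {x = x} = x∈p∪q⁺ (inj₂ (x∈⁅x⁆ x))

p∪⁅x⁆-x⊆p : (p ∪ ⁅ x ⁆) - x ⊆ p
p∪⁅x⁆-x⊆p {p = p} {x = x} y∈ with x∈p∪q⁻ p ⁅ x ⁆ (p─q⊆p _ ⁅ x ⁆ y∈)
... | inj₁ y∈p    = y∈p
... | inj₂ y∈⁅x⁆ =
  contradiction (subst (_∈ _) (x∈⁅y⁆⇒x≡y x y∈⁅x⁆) y∈) (x∉p-x x)

p⊆q⇒x∈q⇒p∪⁅x⁆⊆q : p ⊆ q → x ∈ q → p ∪ ⁅ x ⁆ ⊆ q
p⊆q⇒x∈q⇒p∪⁅x⁆⊆q {p = p} {x = x} p⊆q x∈q y∈ with x∈p∪q⁻ p ⁅ x ⁆ y∈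
... | inj₁ y∈p    = p⊆q y∈p
... | inj₂ y∈⁅x⁆ = subst (_∈ _) (sym (x∈⁅y⁆⇒x≡y x y∈⁅x⁆)) x∈q

0<∣p∣⇒Nonempty : 0 < ∣ p ∣ → Nonempty p
0<∣p∣⇒Nonempty {p = inside ∷ p}  _     = zero , here
0<∣p∣⇒Nonempty {p = outside ∷ p} 0<∣p∣ with 0<∣p∣⇒Nonempty 0<∣p∣
... | x , x∈p = suc x , there x∈p

∣p∣<n⇒∃∉ : {p : Subset n} → ∣ p ∣ < n → ∃ λ x → x ∉ p
∣p∣<n⇒∃∉ {p = p} ∣p∣<n
  with 0<∣p∣⇒Nonempty (subst (0 <_) (sym (∣∁p∣≡n∸∣p∣ p)) (m<n⇒0<n∸m ∣p∣<n))
... | x , x∈∁p = x , x∈∁p⇒x∉p x∈∁p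

p⊆q⇒∣q∣≤∣p∣⇒q⊆p : p ⊆ q → ∣ q ∣ ≤ ∣ p ∣ → q ⊆ p
p⊆q⇒∣q∣≤∣p∣⇒q⊆p {p = p} p⊆q ∣q∣≤∣p∣ {x} x∈q =
  decidable-stable (x ∈? p) λ x∉p → <⇒≱ (p⊂q⇒∣p∣<∣q∣ (p⊆q , x , x∈q , x∉p)) ∣q∣≤∣p∣

Closed : (Subset n → Set) → Subset n → Set
Closed {n} ℋ T = ∀ H → ℋ H → ∀ (v : Fin n) → v ∈ H → H - v ⊆ T → v ∈ T

PhiTrue⇔Closed : (ℋ : Subset n → Set) (T : Subset n) → PhiTrue ℋ T ⇔ Closed ℋ T
PhiTrue⇔Closed ℋ T = mk⇔ phi⇒closed closed⇒phi
  where
  phi⇒closed : PhiTrue ℋ T → Closed ℋ T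
  phi⇒closed φ H H∈ℋ v v∈H H-v⊆T with φ H H∈ℋ v v∈H
  ... | inj₁ H-v⊈T = contradiction (λ {x} → H-v⊆T {x}) H-v⊈T
  ... | inj₂ H⊆T   = H⊆T x∈p∪⁅x⁆
  closed⇒phi : Closed ℋ T → PhiTrue ℋ T
  closed⇒phi closed H H∈ℋ v v∈H with H - v ⊆? T
  ... | no H-v⊈T  = inj₁ H-v⊈T
  ... | yes H-v⊆T =
    inj₂ (p⊆q⇒x∈q⇒p∪⁅x⁆⊆q H-v⊆T (closed H H∈ℋ v v∈H H-v⊆T))

SameFunction⇔SameClosed : {ℋ 𝒢 : Subset n → Set} →
                          SameFunction ℋ 𝒢 ⇔ (∀ T → Closed ℋ T ⇔ Closed 𝒢 T)
SameFunction⇔SameClosed {ℋ = ℋ} {𝒢} = mk⇔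
  (λ same T → ⇔-trans (⇔-sym (PhiTrue⇔Closed ℋ T))
                      (⇔-trans (same T) (PhiTrue⇔Closed 𝒢 T)))
  (λ same T → ⇔-trans (PhiTrue⇔Closed ℋ T)
                      (⇔-trans (same T) (⇔-sym (PhiTrue⇔Closed 𝒢 T))))

Closed-antitone : {ℋ 𝒢 : Subset n → Set} → (∀ {H} → ℋ H → 𝒢 H) →
                  Closed 𝒢 T → Closed ℋ T
Closed-antitone ℋ⊆𝒢 closed H = closed H ∘ ℋ⊆𝒢

FailsAt : Subset n → Subset n → Set
FailsAt H T = ∃ λ v → v ∈ H × H - v ⊆ T × v ∉ T

failsAt? : (H T : Subset n) → Dec (FailsAt H T)
failsAt? H T = any? λ v → v ∈? H ×-dec H - v ⊆? T ×-dec ¬? (v ∈? T)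

FailsAt⇒¬Closed : {ℋ : Subset n → Set} → ℋ H → FailsAt H T → ¬ Closed ℋ T
FailsAt⇒¬Closed H∈ℋ (v , v∈H , H-v⊆T , v∉T) closed =
  v∉T (closed _ H∈ℋ v v∈H H-v⊆T)

p⊆T⇒x∉T⇒FailsAt : p ⊆ T → x ∉ T → FailsAt (p ∪ ⁅ x ⁆) T
p⊆T⇒x∉T⇒FailsAt p⊆T x∉T = _ , x∈p∪⁅x⁆ , ⊆-trans p∪⁅x⁆-x⊆p p⊆T , x∉T

Violated : List (Subset n) → Subset n → Set
Violated D T = ∃ λ H → H ∈ₗ D × FailsAt H T

violated? : (D : List (Subset n)) (T : Subset n) → Dec (Violated D T)
violated? D T =
  map′ find (λ (H , H∈D , fails) → lose H∈D fails) (Any.any? (λ H → failsAt? H T) D)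

Violated⇒¬Closed : {D : List (Subset n)} → Violated D T → ¬ Closed (ListFamily D) T
Violated⇒¬Closed (H , H∈D , fails) = FailsAt⇒¬Closed H∈D fails

¬Closed⇒Violated : {D : List (Subset n)} → ¬ Closed (ListFamily D) T → Violated D T
¬Closed⇒Violated {T = T} {D} ¬closed = decidable-stable (violated? D T) λ ¬violated →
  ¬closed λ H H∈D v v∈H H-v⊆T → decidable-stable (v ∈? T) λ v∉T →
    ¬violated (H , H∈D , v , v∈H , H-v⊆T , v∉T)

∣circuit-x∣≡r : UniformCircuit r H → x ∈ H → ∣ H - x ∣ ≡ r
∣circuit-x∣≡r ∣H∣≡1+r x∈H =
  suc-injective (trans (x∈p⇒suc∣p-x∣≡∣p∣ x∈H) ∣H∣≡1+r)

¬Closed-uniform : S ⊆ T → ∣ S ∣ ≡ r → x ∉ T → ¬ Closed (UniformCircuit r) T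
¬Closed-uniform S⊆T refl x∉T =
  FailsAt⇒¬Closed (x∉p⇒∣p∪⁅x⁆∣≡suc∣p∣ (x∉T ∘ S⊆T))
                  (p⊆T⇒x∉T⇒FailsAt S⊆T x∉T)

module _ {D : List (Subset n)} (1+r<n : suc r < n) (circuits : All (UniformCircuit r) D)
         (same : SameFunction (ListFamily D) (UniformCircuit r)) where

  private
    rSets : List (Subset n)
    rSets = subsetsOfSize n r

    coverage : Subset n → ℕ
    coverage B = count (B ⊆?_) D

    multipleCoverage : Subset n → ℕ
    multipleCoverage B = count (λ H → 2 ≤? coverage B ×-dec B ⊆? H) D

    violated : S ⊆ T → ∣ S ∣ ≡ r → x ∉ T → Violated D T
    violated {T = T} S⊆T ∣S∣ x∉T = ¬Closed⇒Violated
      (¬Closed-uniform S⊆T ∣S∣ x∉T ∘ to (to SameFunction⇔SameClosed same T))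

  coverage-pos : {B : Subset n} → ∣ B ∣ ≡ r → 0 < coverage B
  coverage-pos {B} ∣B∣ with ∣p∣<n⇒∃∉ (≤-trans (s≤s (≤-reflexive ∣B∣)) (<⇒≤ 1+r<n))
  ... | w , w∉B with violated ⊆-refl ∣B∣ w∉B
  ... | H , H∈D , v , v∈H , H-v⊆B , _ =
    count-pos (B ⊆?_) H∈D (p─q⊆p H ⁅ v ⁆ ∘ B⊆H-v)
    where
    B⊆H-v : B ⊆ H - v
    B⊆H-v = p⊆q⇒∣q∣≤∣p∣⇒q⊆p H-v⊆B
      (≤-reflexive (trans ∣B∣ (sym (∣circuit-x∣≡r (lookup circuits H∈D) v∈H))))

  shared-face : H ∈ₗ D → ∃ λ B → ∣ B ∣ ≡ r × B ⊆ H × 2 ≤ coverage B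
  shared-face {H} H∈D
    with 0<∣p∣⇒Nonempty {p = H} (subst (0 <_) (sym (lookup circuits H∈D)) (s≤s z≤n))
  ... | v , v∈H with ∣p∣<n⇒∃∉ {p = H} (subst (_< n) (sym (lookup circuits H∈D)) 1+r<n)
  ... | w , w∉H
    with violated (p─q⊆p H ⁅ v ⁆) (∣circuit-x∣≡r (lookup circuits H∈D) v∈H) w∉H
  ... | H′ , H′∈D , v′ , v′∈H′ , H′-v′⊆H , v′∉H =
    H′ - v′ , ∣circuit-x∣≡r (lookup circuits H′∈D) v′∈H′ , H′-v′⊆H ,
    count≥2 (H′ - v′ ⊆?_) H∈D H′∈D (λ { refl → v′∉H v′∈H′ })
            H′-v′⊆H (p─q⊆p H′ ⁅ v′ ⁆)

  2+multipleCoverage≤2*coverage : {B : Subset n} → ∣ B ∣ ≡ r →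
                                  2 + multipleCoverage B ≤ 2 * coverage B
  2+multipleCoverage≤2*coverage {B} ∣B∣ = by-cases (2 ≤? coverage B)
    where
    open ≤-Reasoning
    by-cases : Dec (2 ≤ coverage B) → 2 + multipleCoverage B ≤ 2 * coverage B
    by-cases (yes 2≤c) = begin
      2 + multipleCoverage B   ≡⟨ cong (2 +_) (count-cong _ (B ⊆?_) D λ _ → mk⇔ proj₂ (2≤c ,_)) ⟩
      2 + coverage B           ≤⟨ +-monoˡ-≤ (coverage B) 2≤c ⟩
      coverage B + coverage B  ≡⟨ cong (coverage B +_) (sym (+-identityʳ (coverage B))) ⟩
      2 * coverage B           ∎
    by-cases (no 2≰c) = begin
      2 + multipleCoverage B   ≡⟨ cong (2 +_) (count-none _ D λ _ → 2≰c ∘ proj₁) ⟩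
      2 * 1                    ≤⟨ *-monoʳ-≤ 2 (coverage-pos ∣B∣) ⟩
      2 * coverage B           ∎

  ∑coverage≡[1+r]*∣D∣ : ∑[ B ∈ rSets ] coverage B ≡ suc r * length D
  ∑coverage≡[1+r]*∣D∣ = begin
    ∑[ B ∈ rSets ] coverage B       ≡⟨ ∑-swap rSets D (λ B H → indicator (B ⊆? H)) ⟩
    ∑[ H ∈ D ] count (_⊆? H) rSets  ≡⟨ ∑-cong D faces ⟩
    ∑[ H ∈ D ] suc r                ≡⟨ ∑-const (suc r) D ⟩
    suc r * length D                ∎
    where
    open ≡-Reasoning
    faces : ∀ {H} → H ∈ₗ D → count (_⊆? H) rSets ≡ suc r
    faces {H} H∈D = begin
      count (_⊆? H) rSets  ≡⟨ count-⊆-subsetsOfSize n r H ⟩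
      ∣ H ∣ C r            ≡⟨ cong (_C r) (lookup circuits H∈D) ⟩
      suc r C r            ≡⟨ [1+n]Cn≡1+n r ⟩
      suc r                ∎

  ∣D∣≤∑multipleCoverage : length D ≤ ∑[ B ∈ rSets ] multipleCoverage B
  ∣D∣≤∑multipleCoverage = begin
    length D      ≡⟨ sym (trans (∑-const 1 D) (*-identityˡ (length D))) ⟩
    ∑[ H ∈ D ] 1  ≤⟨ ∑-mono D shared-faces ⟩
    ∑[ H ∈ D ] count (λ B → 2 ≤? coverage B ×-dec B ⊆? H) rSets
      ≡⟨ ∑-swap rSets D (λ B H → indicator (2 ≤? coverage B ×-dec B ⊆? H)) ⟨
    ∑[ B ∈ rSets ] multipleCoverage B ∎
    where
    open ≤-Reasoning
    shared-faces : ∀ {H} → H ∈ₗ D → 1 ≤ count (λ B → 2 ≤? coverage B ×-dec B ⊆? H) rSets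
    shared-faces {H} H∈D with shared-face H∈D
    ... | B , ∣B∣ , B⊆H , 2≤c =
      count-pos (λ B → 2 ≤? coverage B ×-dec B ⊆? H) (∈-subsetsOfSize⁺ ∣B∣) (2≤c , B⊆H)

  lower-bound : 2 * (n C r) ≤ (2 * r + 1) * length D
  lower-bound = +-cancelʳ-≤ (length D) _ _ (begin
    2 * (n C r) + length D                     ≤⟨ +-monoʳ-≤ (2 * (n C r)) ∣D∣≤∑multipleCoverage ⟩
    2 * (n C r) + ∑[ B ∈ rSets ] multipleCoverage B
      ≡⟨ cong (_+ ∑[ B ∈ rSets ] multipleCoverage B) 2*nCr≡∑2 ⟩
    ∑[ B ∈ rSets ] 2 + ∑[ B ∈ rSets ] multipleCoverage B
      ≡⟨ ∑-+ rSets (λ _ → 2) multipleCoverage ⟨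
    ∑[ B ∈ rSets ] (2 + multipleCoverage B)
      ≤⟨ ∑-mono rSets (2+multipleCoverage≤2*coverage ∘ ∈-subsetsOfSize⁻) ⟩
    ∑[ B ∈ rSets ] (2 * coverage B)            ≡⟨ ∑-* 2 rSets coverage ⟩
    2 * ∑[ B ∈ rSets ] coverage B              ≡⟨ cong (2 *_) ∑coverage≡[1+r]*∣D∣ ⟩
    2 * (suc r * length D)                     ≡⟨ regroup r (length D) ⟩
    (2 * r + 1) * length D + length D          ∎)
    where
    open ≤-Reasoning
    2*nCr≡∑2 : 2 * (n C r) ≡ ∑[ B ∈ rSets ] 2
    2*nCr≡∑2 = trans (cong (2 *_) (sym (length-subsetsOfSize n r))) (sym (∑-const 2 rSets))
    regroup : ∀ r d → 2 * (suc r * d) ≡ (2 * r + 1) * d + d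
    regroup = solve 2 (λ r d → con 2 :* ((con 1 :+ r) :* d) := (con 2 :* r :+ con 1) :* d :+ d) refl
      where open +-*-Solver

star : (m k : ℕ) → List (Subset (suc m))
star m k = map (inside ∷_) (subsetsOfSize m k)

star-unique : ∀ {m k} → Unique (star m k)
star-unique {m} {k} = Unique.map⁺ ∷-injectiveʳ (subsetsOfSize-unique m k)

star-circuits : ∀ {m k} → All (UniformCircuit k) (star m k)
star-circuits {m} {k} = tabulate circuit
  where
  circuit : ∀ {X} → X ∈ₗ star m k → UniformCircuit k X
  circuit X∈ with ∈-map⁻ (inside ∷_) X∈
  ... | B , B∈ , refl = cong suc (∈-subsetsOfSize⁻ B∈)

∈-star : ∀ {m k} {X : Subset (suc m)} → UniformCircuit k X → zero ∈ X → X ∈ₗ star m k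
∈-star {X = inside ∷ X} ∣X∣ here =
  ∈-map⁺ (inside ∷_) (∈-subsetsOfSize⁺ (suc-injective ∣X∣))

length-star : ∀ {m k} → length (star m (suc k)) ≤ suc m C suc k
length-star {m} {k} = begin
  length (star m (suc k))           ≡⟨ length-map (inside ∷_) (subsetsOfSize m (suc k)) ⟩
  length (subsetsOfSize m (suc k))  ≡⟨ length-subsetsOfSize m (suc k) ⟩
  m C suc k                         ≤⟨ m≤n+m (m C suc k) (m C k) ⟩
  m C k + m C suc k                 ≡⟨ nCk+nC[k+1]≡[n+1]C[k+1] m k ⟩
  suc m C suc k                     ∎
  where open ≤-Reasoning

star-violated-through-zero : ∀ {m k} {S T : Subset (suc m)} {x : Fin (suc m)} →
  S ⊆ T → ∣ S ∣ ≡ k → x ∉ T → zero ∈ S ∪ ⁅ x ⁆ → Violated (star m k) T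
star-violated-through-zero S⊆T ∣S∣ x∉T 0∈ =
  _ , ∈-star (trans (x∉p⇒∣p∪⁅x⁆∣≡suc∣p∣ (x∉T ∘ S⊆T)) (cong suc ∣S∣)) 0∈ ,
  p⊆T⇒x∉T⇒FailsAt S⊆T x∉T

star-violated : ∀ {m k} {S T : Subset (suc m)} {x : Fin (suc m)} →
                S ⊆ T → ∣ S ∣ ≡ suc k → x ∉ T → Violated (star m (suc k)) T
star-violated {S = S} {T} S⊆T ∣S∣ x∉T with zero ∈? T | zero ∈? S
... | no 0∉T  | _       = star-violated-through-zero S⊆T ∣S∣ 0∉T x∈p∪⁅x⁆
... | yes _   | yes 0∈S = star-violated-through-zero S⊆T ∣S∣ x∉T (x∈p∪q⁺ (inj₁ 0∈S))
... | yes 0∈T | no 0∉S with 0<∣p∣⇒Nonempty {p = S} (subst (0 <_) (sym ∣S∣) (s≤s z≤n))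
...   | y , y∈S = star-violated-through-zero
  (p⊆q⇒x∈q⇒p∪⁅x⁆⊆q (S⊆T ∘ p─q⊆p S ⁅ y ⁆) 0∈T)
  (trans (x∉p⇒y∈p⇒∣p-y∪⁅x⁆∣≡∣p∣ 0∉S y∈S) ∣S∣)
  x∉T
  (x∈p∪q⁺ (inj₁ x∈p∪⁅x⁆))

star-sameFunction : ∀ {m k} →
                    SameFunction (ListFamily (star m (suc k))) (UniformCircuit (suc k))
star-sameFunction {m} {k} = from SameFunction⇔SameClosed λ T →
  mk⇔ (star-closed⇒closed T) (Closed-antitone (lookup star-circuits))
  where
  star-closed⇒closed : ∀ T → Closed (ListFamily (star m (suc k))) T →
                       Closed (UniformCircuit (suc k)) T
  star-closed⇒closed T closed H ∣H∣ v v∈H H-v⊆T = decidable-stable (v ∈? T) λ v∉T →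
    Violated⇒¬Closed (star-violated H-v⊆T (∣circuit-x∣≡r ∣H∣ v∈H) v∉T) closed

theorem20 : (r n : ℕ) → 1 ≤ r → n ≥ r + 2 →
    -- upper bound: some subfamily 𝒟 ⊆ 𝒞 with Φ_𝒟 = Φ_𝒞 has |𝒟| ≤ C(n,r)
    (Σ (List (Subset n)) λ 𝒟 → Unique 𝒟 × All (UniformCircuit r) 𝒟
        × SameFunction (ListFamily 𝒟) (UniformCircuit r) × length 𝒟 ≤ n C r)
    ×
    -- lower bound: every such 𝒟 has C(n,r) / (r + 1/2) ≤ |𝒟|, i.e. 2·C(n,r) ≤ (2r+1)·|𝒟|
    ((𝒟 : List (Subset n)) → Unique 𝒟 → All (UniformCircuit r) 𝒟 →
        SameFunction (ListFamily 𝒟) (UniformCircuit r) →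
        2 * (n C r) ≤ (2 * r + 1) * length 𝒟)
theorem20 (suc k) (suc m) _ n≥r+2 =
  (star m (suc k) , star-unique , star-circuits , star-sameFunction , length-star {k = k}) ,
  λ 𝒟 _ circuits same → lower-bound 1+r<n circuits same
  where
  1+r<n : suc (suc k) < suc m
  1+r<n = ≤-trans (≤-reflexive (+-comm 2 (suc k))) n≥r+2
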